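{- Let $m \ge 1$, let $R_m = \mathbb{Z}[x_1,\ldots,x_m]$, let $n \ge 2$, let $f \in R_m$, and let $1 \le i < j \le m$. Then $c_{f^{2^n}}(x_i x_j)/2^n$ and $c_{f^{2^n}}(x_i^{2^{n-1}} x_j^{2^{n-1}})/2$ are integers, and $$\frac{c_{f^{2^n}}(x_i x_j)}{2^n} + \frac{c_{f^{2^n}}(x_i^{2^{n-1}} x_j^{2^{n-1}})}{2} \equiv (c_f(1) + 1)\, c_f(x_i)\, c_f(x_j) \pmod{2\mathbb{Z}}.$$
   Context: Every polynomial $g \in R_m = \mathbb{Z}[x_1,\ldots,x_m]$ is written as $g = \sum_\alpha c_g(x^\alpha) x^\alpha$, where $\alpha = (\alpha_1,\ldots,\alpha_m)$ ranges over vectors of non-negative integers, $x^\alpha = \prod_{i=1}^m x_i^{\alpha_i}$, and $c_g(x^\alpha) \in \mathbb{Z}$ is the coefficient of the monomial $x^\alpha$ in $g$ (zero for almost all $\alpha$). In particular $c_g(1)$ is the constant term of $g$. -}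

module Defs where

open import Data.Nat as ℕ using (ℕ; zero; suc)
open import Data.Integer as ℤ using (ℤ; +_)
open import Data.Fin using (Fin)
open import Data.Fin.Properties as FinP using ()
open import Data.Vec using (Vec; zipWith; tabulate; replicate)
open import Data.Vec.Properties using (≡-dec)
open import Data.List using (List; []; _∷_; map; concatMap; foldr)
open import Data.Product using (_×_; _,_; proj₁; proj₂)
open import Relation.Nullary using (does)
open import Data.Bool using (if_then_else_)

Exp : ℕ → Set
Exp m = Vec ℕ m

-- A polynomial in ℤ[x_1,…,x_m], represented as a finite formal sum
-- Σ c · x^α of terms (c , α).  Repeated exponents are allowed; the
-- coefficient of a monomial is the sum of all matching terms.
Poly : ℕ → Set
Poly m = List (ℤ × Exp m)

coeff : ∀ {m} → Poly m → Exp m → ℤ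
coeff g α = foldr ℤ._+_ (+ 0) (map (λ t → if does (≡-dec ℕ._≟_ (proj₂ t) α) then proj₁ t else + 0) g)

_*P_ : ∀ {m} → Poly m → Poly m → Poly m
f *P g = concatMap (λ s → map (λ t → (proj₁ s ℤ.* proj₁ t , zipWith ℕ._+_ (proj₂ s) (proj₂ t))) g) f

oneP : ∀ {m} → Poly m
oneP {m} = (+ 1 , replicate m 0) ∷ []

_^P_ : ∀ {m} → Poly m → ℕ → Poly m
f ^P zero = oneP
f ^P suc k = f *P (f ^P k)

expOne : ∀ {m} → Exp m
expOne {m} = replicate m 0

-- exponent of x_i^a x_j^b  (for i ≠ j)
expPair : ∀ {m} → Fin m → ℕ → Fin m → ℕ → Exp m
expPair i a j b = tabulate (λ l →
  (if does (l FinP.≟ i) then a else 0) ℕ.+ (if does (l FinP.≟ j) then b else 0))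

expVar : ∀ {m} → Fin m → Exp m
expVar i = tabulate (λ l → if does (l FinP.≟ i) then 1 else 0)

module Submission where

-- Fix i < j and set every variable other than x_i, x_j to 0.
-- This projection is multiplicative and keeps the coefficients of all
-- monomials x_i^a x_j^b, so the theorem is a statement about a polynomial
-- g in X = x_i, Y = x_j, with coefficients g_ab of X^a Y^b, c = g₀₀,
-- x = g₁₀, y = g₀₁, d = g₁₁, and N = 2^n.
--
--  * xy-coefficient: an induction on N gives the exact formula
--      [XY] g^N = N · (c^(N-1) d + (N-1) c^(N-2) x y)  (N ≥ 2),
--    so a = c^(N-1) d + (N-1) c^(N-2) x y ≡ c d + c x y  (mod 2).
--  * diagonal coefficient: writing N = 2k (k = 2^(n-1)), squaring doubles
--    2-adic precision (u ≡ v mod 2 ⇒ u² ≡ v² mod 4) and g² ≡ frob g (mod 2),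
--    where frob squares each term separately; hence g^N ≡ h² (mod 4) with
--    h = frob^(n-1) g, all of whose exponents are multiples of k.  In h² the
--    only contributions to X^k Y^k are h₀₀h_kk and h₀ₖh_k0, each twice, and
--    h_{ka,kb} ≡ g_{ab} (mod 2); so b ≡ c d + x y (mod 2).
-- Adding, a + b ≡ (c + 1) x y (mod 2).

open import Defs
open import Data.Nat as ℕ using (ℕ; _≤_; zero; suc; z≤n; s≤s)
open import Data.Integer as ℤ using (ℤ; +_; -[1+_]; _+_; _*_; -_; _-_)
open import Data.Integer.Divisibility using (_∣_)
open import Data.Fin using (Fin; _<_)
open import Data.Product using (Σ; _×_; _,_; proj₁; proj₂)
open import Relation.Binary.PropositionalEquality
  using (_≡_; refl; sym; trans; cong; cong₂; subst; module ≡-Reasoning)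

import Data.Nat.Properties as ℕP
import Data.Nat.Divisibility as ℕD
import Data.Nat.Tactic.RingSolver as ℕSolver
import Data.Integer.Properties as ℤP
open import Data.Integer.Tactic.RingSolver using (solve-∀)
import Data.Fin.Properties as FinP
open import Data.Vec using (lookup; tabulate; zipWith; replicate)
open import Data.Vec.Properties
  using (≡-dec; lookup∘tabulate; tabulate∘lookup; tabulate-cong; lookup-zipWith; lookup-replicate)
open import Data.List using (List; []; _∷_; map; _++_; concatMap)
open import Data.List.Relation.Unary.All using (All; []; _∷_)
open import Data.Bool using (if_then_else_)
open import Data.Bool.Properties using (if-eta)
open import Relation.Nullary using (does; yes; no; ¬_; Dec)
open import Relation.Nullary.Decidable using (_→-dec_; ¬?)
open import Data.Empty using (⊥-elim)

if-yes : {P A : Set} {z w : A} (d : Dec P) → P → (if does d then z else w) ≡ z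
if-yes (yes _) _ = refl
if-yes (no ¬p) p = ⊥-elim (¬p p)

if-no : {P A : Set} {z w : A} (d : Dec P) → ¬ P → (if does d then z else w) ≡ w
if-no (yes p) ¬p = ⊥-elim (¬p p)
if-no (no _) _ = refl

sumL : {A : Set} → (A → ℤ) → List A → ℤ
sumL F [] = + 0
sumL F (x ∷ l) = F x + sumL F l

sumL-cong : {A : Set} {F G : A → ℤ} (l : List A) → (∀ x → F x ≡ G x) → sumL F l ≡ sumL G l
sumL-cong [] e = refl
sumL-cong (x ∷ l) e = cong₂ _+_ (e x) (sumL-cong l e)

sumL-++ : {A : Set} (F : A → ℤ) (l l' : List A) → sumL F (l ++ l') ≡ sumL F l + sumL F l'
sumL-++ F [] l' = sym (ℤP.+-identityˡ _)
sumL-++ F (x ∷ l) l' = trans (cong (_+_ (F x)) (sumL-++ F l l')) (sym (ℤP.+-assoc (F x) _ _))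

sumL-map : {A B : Set} (F : B → ℤ) (g : A → B) (l : List A) → sumL F (map g l) ≡ sumL (λ x → F (g x)) l
sumL-map F g [] = refl
sumL-map F g (x ∷ l) = cong (_+_ (F (g x))) (sumL-map F g l)

sumL-concatMap : {A B : Set} (F : B → ℤ) (h : A → List B) (l : List A) →
  sumL F (concatMap h l) ≡ sumL (λ s → sumL F (h s)) l
sumL-concatMap F h [] = refl
sumL-concatMap F h (x ∷ l) = trans (sumL-++ F (h x) (concatMap h l)) (cong (_+_ (sumL F (h x))) (sumL-concatMap F h l))

sumL-+ : {A : Set} (F G : A → ℤ) (l : List A) → sumL (λ x → F x + G x) l ≡ sumL F l + sumL G l
sumL-+ F G [] = refl
sumL-+ F G (x ∷ l) rewrite sumL-+ F G l = swap-middle (F x) (G x) (sumL F l) (sumL G l)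
  where swap-middle : ∀ a b c d → a + b + (c + d) ≡ a + c + (b + d)
        swap-middle = solve-∀

sumL-* : {A : Set} (k : ℤ) (F : A → ℤ) (l : List A) → sumL (λ x → k * F x) l ≡ k * sumL F l
sumL-* k F [] = sym (ℤP.*-zeroʳ k)
sumL-* k F (x ∷ l) rewrite sumL-* k F l = sym (ℤP.*-distribˡ-+ k (F x) (sumL F l))

sumL-0 : {A : Set} (l : List A) → sumL (λ _ → + 0) l ≡ + 0
sumL-0 [] = refl
sumL-0 (x ∷ l) = trans (ℤP.+-identityˡ _) (sumL-0 l)

sumL-swap : {A B : Set} (H : A → B → ℤ) (p : List A) (q : List B) →
  sumL (λ s → sumL (H s) q) p ≡ sumL (λ t → sumL (λ s → H s t) p) q
sumL-swap H [] q = sym (sumL-0 q)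
sumL-swap H (s ∷ p) q = trans (cong (_+_ (sumL (H s) q)) (sumL-swap H p q))
  (sym (sumL-+ (H s) (λ t → sumL (λ s → H s t) p) q))

sumTo : (ℕ → ℤ) → ℕ → ℤ
sumTo F zero = F 0
sumTo F (suc a) = sumTo F a + F (suc a)

sumBox : (ℕ → ℕ → ℤ) → ℕ → ℕ → ℤ
sumBox F a b = sumTo (λ a' → sumTo (F a') b) a

sumTo-cong : ∀ {F G : ℕ → ℤ} a → (∀ x → F x ≡ G x) → sumTo F a ≡ sumTo G a
sumTo-cong zero e = e 0
sumTo-cong (suc a) e = cong₂ _+_ (sumTo-cong a e) (e (suc a))

sumTo-+ : ∀ (F G : ℕ → ℤ) a → sumTo (λ x → F x + G x) a ≡ sumTo F a + sumTo G a
sumTo-+ F G zero = refl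
sumTo-+ F G (suc a) rewrite sumTo-+ F G a = swap-middle (sumTo F a) (sumTo G a) (F (suc a)) (G (suc a))
  where swap-middle : ∀ a b c d → a + b + (c + d) ≡ a + c + (b + d)
        swap-middle = solve-∀

sumTo-* : ∀ (k : ℤ) (F : ℕ → ℤ) a → sumTo (λ x → k * F x) a ≡ k * sumTo F a
sumTo-* k F zero = refl
sumTo-* k F (suc a) rewrite sumTo-* k F a = sym (ℤP.*-distribˡ-+ k (sumTo F a) (F (suc a)))

sumTo-0 : ∀ a → sumTo (λ _ → + 0) a ≡ + 0
sumTo-0 zero = refl
sumTo-0 (suc a) rewrite sumTo-0 a = refl

sumTo-sumL : {A : Set} (H : ℕ → A → ℤ) (l : List A) (a : ℕ) →
  sumTo (λ a' → sumL (H a') l) a ≡ sumL (λ s → sumTo (λ a' → H a' s) a) l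
sumTo-sumL H [] a = sumTo-0 a
sumTo-sumL H (s ∷ l) a = trans (sumTo-+ (λ a' → H a' s) (λ a' → sumL (H a') l) a)
  (cong (_+_ (sumTo (λ a' → H a' s) a)) (sumTo-sumL H l a))

sumTo-ends : ∀ (F : ℕ → ℤ) k → (∀ a → 0 ℕ.< a → a ℕ.< suc k → F a ≡ + 0) →
  sumTo F (suc k) ≡ F 0 + F (suc k)
sumTo-ends F k inner = cong (_+ F (suc k)) (initial k ℕP.≤-refl)
  where initial : ∀ a → a ≤ k → sumTo F a ≡ F 0
        initial zero _ = refl
        initial (suc a) a<k = trans (cong₂ _+_ (initial a (ℕP.<⇒≤ a<k)) (inner (suc a) (s≤s z≤n) (s≤s a<k)))
                                    (ℤP.+-identityʳ _)

sumBox-cong : ∀ {F G : ℕ → ℕ → ℤ} a b → (∀ x y → F x y ≡ G x y) → sumBox F a b ≡ sumBox G a b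
sumBox-cong a b e = sumTo-cong a (λ x → sumTo-cong b (e x))

sumBox-+ : ∀ (F G : ℕ → ℕ → ℤ) a b → sumBox (λ x y → F x y + G x y) a b ≡ sumBox F a b + sumBox G a b
sumBox-+ F G a b = trans (sumTo-cong a (λ x → sumTo-+ (F x) (G x) b)) (sumTo-+ (λ x → sumTo (F x) b) (λ x → sumTo (G x) b) a)

sumBox-* : ∀ (d : ℤ) (F : ℕ → ℕ → ℤ) a b → sumBox (λ x y → d * F x y) a b ≡ d * sumBox F a b
sumBox-* d F a b = trans (sumTo-cong a (λ x → sumTo-* d (F x) b)) (sumTo-* d (λ x → sumTo (F x) b) a)

sumBox-lin : ∀ (F G : ℕ → ℕ → ℤ) (d : ℤ) a b →
  sumBox (λ x y → F x y + d * G x y) a b ≡ sumBox F a b + d * sumBox G a b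
sumBox-lin F G d a b = trans (sumBox-+ F (λ x y → d * G x y) a b) (cong (_+_ (sumBox F a b)) (sumBox-* d G a b))

-- Bivariate polynomials

-- A term c · X^a · Y^b, and a polynomial as a finite formal sum of terms.
BiTerm : Set
BiTerm = ℤ × ℕ × ℕ

BiPoly : Set
BiPoly = List BiTerm

-- δ x a z = z if x = a and 0 otherwise; kept opaque so that it is only
-- ever used through the lemmas below.
opaque
  δ : ℕ → ℕ → ℤ → ℤ
  δ x a z = if does (x ℕ.≟ a) then z else + 0

termCoeff : ℕ → ℕ → BiTerm → ℤ
termCoeff a b (c , x , y) = δ x a (δ y b c)

coeff₂ : BiPoly → ℕ → ℕ → ℤ
coeff₂ p a b = sumL (termCoeff a b) p

term* : BiTerm → BiTerm → BiTerm
term* (c , x , y) (d , u , v) = (c * d , x ℕ.+ u , y ℕ.+ v)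

infixl 7 _⊗_
_⊗_ : BiPoly → BiPoly → BiPoly
[] ⊗ q = []
(s ∷ p) ⊗ q = map (term* s) q ++ (p ⊗ q)

one₂ : BiPoly
one₂ = (+ 1 , 0 , 0) ∷ []

pow : BiPoly → ℕ → BiPoly
pow p zero = one₂
pow p (suc k) = p ⊗ pow p k

infix 4 _≈_
record _≈_ (p q : BiPoly) : Set where
  constructor mk≈
  field at : ∀ a b → coeff₂ p a b ≡ coeff₂ q a b
open _≈_ public

≈-refl : ∀ {p} → p ≈ p
≈-refl = mk≈ λ a b → refl

≈-sym : ∀ {p q} → p ≈ q → q ≈ p
≈-sym e = mk≈ λ a b → sym (at e a b)

≈-trans : ∀ {p q r} → p ≈ q → q ≈ r → p ≈ r
≈-trans e f = mk≈ λ a b → trans (at e a b) (at f a b)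

coeff₂-++ : ∀ p q a b → coeff₂ (p ++ q) a b ≡ coeff₂ p a b + coeff₂ q a b
coeff₂-++ p q a b = sumL-++ (termCoeff a b) p q

sumL-⊗ : (F : BiTerm → ℤ) (p q : BiPoly) → sumL F (p ⊗ q) ≡ sumL (λ s → sumL (λ t → F (term* s t)) q) p
sumL-⊗ F [] q = refl
sumL-⊗ F (s ∷ p) q = trans (sumL-++ F (map (term* s) q) (p ⊗ q))
  (cong₂ _+_ (sumL-map F (term* s) q) (sumL-⊗ F p q))

term*-comm : ∀ s t → term* s t ≡ term* t s
term*-comm (c , x , y) (d , u , v) rewrite ℤP.*-comm c d | ℕP.+-comm x u | ℕP.+-comm y v = refl

term*-assoc : ∀ s t w → term* (term* s t) w ≡ term* s (term* t w)
term*-assoc (c , x , y) (d , u , v) (e , r , z)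
  rewrite ℤP.*-assoc c d e | ℕP.+-assoc x u r | ℕP.+-assoc y v z = refl

⊗-comm : ∀ p q → p ⊗ q ≈ q ⊗ p
⊗-comm p q = mk≈ λ a b → begin
  sumL (termCoeff a b) (p ⊗ q)                                ≡⟨ sumL-⊗ (termCoeff a b) p q ⟩
  sumL (λ s → sumL (λ t → termCoeff a b (term* s t)) q) p     ≡⟨ sumL-swap (λ s t → termCoeff a b (term* s t)) p q ⟩
  sumL (λ t → sumL (λ s → termCoeff a b (term* s t)) p) q
    ≡⟨ sumL-cong q (λ t → sumL-cong p (λ s → cong (termCoeff a b) (term*-comm s t))) ⟩
  sumL (λ t → sumL (λ s → termCoeff a b (term* t s)) p) q     ≡⟨ sym (sumL-⊗ (termCoeff a b) q p) ⟩
  sumL (termCoeff a b) (q ⊗ p)                                ∎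
  where open ≡-Reasoning

⊗-assoc : ∀ p q r → (p ⊗ q) ⊗ r ≈ p ⊗ (q ⊗ r)
⊗-assoc p q r = mk≈ λ a b → assoc-for (termCoeff a b)
  where
  open ≡-Reasoning
  assoc-for : (F : BiTerm → ℤ) → sumL F ((p ⊗ q) ⊗ r) ≡ sumL F (p ⊗ (q ⊗ r))
  assoc-for F = begin
    sumL F ((p ⊗ q) ⊗ r)                                            ≡⟨ sumL-⊗ F (p ⊗ q) r ⟩
    sumL (λ u → sumL (λ w → F (term* u w)) r) (p ⊗ q)               ≡⟨ sumL-⊗ (λ u → sumL (λ w → F (term* u w)) r) p q ⟩
    sumL (λ s → sumL (λ t → sumL (λ w → F (term* (term* s t) w)) r) q) p
      ≡⟨ sumL-cong p (λ s → sumL-cong q (λ t → sumL-cong r (λ w → cong F (term*-assoc s t w)))) ⟩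
    sumL (λ s → sumL (λ t → sumL (λ w → F (term* s (term* t w))) r) q) p
      ≡⟨ sumL-cong p (λ s → sym (sumL-⊗ (λ u → F (term* s u)) q r)) ⟩
    sumL (λ s → sumL (λ u → F (term* s u)) (q ⊗ r)) p               ≡⟨ sym (sumL-⊗ F p (q ⊗ r)) ⟩
    sumL F (p ⊗ (q ⊗ r))                                            ∎

one-⊗ : ∀ p → one₂ ⊗ p ≈ p
one-⊗ p = mk≈ λ a b → begin
  sumL (termCoeff a b) (map unit* p ++ [])        ≡⟨ sumL-++ (termCoeff a b) (map unit* p) [] ⟩
  sumL (termCoeff a b) (map unit* p) + + 0         ≡⟨ ℤP.+-identityʳ _ ⟩
  sumL (termCoeff a b) (map unit* p)               ≡⟨ sumL-map (termCoeff a b) unit* p ⟩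
  sumL (λ t → termCoeff a b (unit* t)) p           ≡⟨ sumL-cong p (λ t → cong (termCoeff a b) (unit*-id t)) ⟩
  sumL (termCoeff a b) p                           ∎
  where open ≡-Reasoning
        unit* : BiTerm → BiTerm
        unit* = term* (+ 1 , 0 , 0)
        unit*-id : ∀ t → unit* t ≡ t
        unit*-id (d , u , v) rewrite ℤP.*-identityˡ d = refl

⊗-one : ∀ p → p ⊗ one₂ ≈ p
⊗-one p = ≈-trans (⊗-comm p one₂) (one-⊗ p)

opaque
  unfolding δ
  δ-yes : ∀ {x a z} → x ≡ a → δ x a z ≡ z
  δ-yes {x} {a} e = if-yes (x ℕ.≟ a) e

  δ-no : ∀ {x a z} → ¬ x ≡ a → δ x a z ≡ + 0
  δ-no {x} {a} n = if-no (x ℕ.≟ a) n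

δ-0 : ∀ x a → δ x a (+ 0) ≡ + 0
δ-0 x a with x ℕ.≟ a
... | yes e = δ-yes e
... | no n = δ-no n

δ-cong : ∀ x a {z w} → z ≡ w → δ x a z ≡ δ x a w
δ-cong x a refl = refl

δ-*l : ∀ k x a z → k * δ x a z ≡ δ x a (k * z)
δ-*l k x a z with x ℕ.≟ a
... | yes e = trans (cong (k *_) (δ-yes e)) (sym (δ-yes e))
... | no n = trans (cong (k *_) (δ-no n)) (trans (ℤP.*-zeroʳ k) (sym (δ-no n)))

δ-*r : ∀ x a z w → δ x a z * w ≡ δ x a (z * w)
δ-*r x a z w with x ℕ.≟ a
... | yes e = trans (cong (_* w) (δ-yes e)) (sym (δ-yes e))
... | no n = trans (cong (_* w) (δ-no n)) (sym (δ-no n))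

sumTo-δin : ∀ x a' (G : ℕ → ℤ) b → sumTo (λ b' → δ x a' (G b')) b ≡ δ x a' (sumTo G b)
sumTo-δin x a' G b with x ℕ.≟ a'
... | yes e = trans (sumTo-cong b (λ b' → δ-yes e)) (sym (δ-yes e))
... | no n = trans (sumTo-cong b (λ b' → δ-no n)) (trans (sumTo-0 b) (sym (δ-no n)))

sumTo-δ-out : ∀ x (Z : ℕ → ℤ) a → ¬ x ≤ a → sumTo (λ a' → δ x a' (Z a')) a ≡ + 0
sumTo-δ-out x Z zero n = δ-no (λ e → n (subst (_≤ 0) (sym e) z≤n))
sumTo-δ-out x Z (suc a) n = cong₂ _+_ (sumTo-δ-out x Z a (λ le → n (ℕP.m≤n⇒m≤1+n le)))
  (δ-no (λ e → n (subst (_≤ suc a) (sym e) ℕP.≤-refl)))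

sumTo-δ-in : ∀ x (Z : ℕ → ℤ) a → x ≤ a → sumTo (λ a' → δ x a' (Z a')) a ≡ Z x
sumTo-δ-in x Z zero le with ℕP.n≤0⇒n≡0 le
... | refl = δ-yes refl
sumTo-δ-in x Z (suc a) le with x ℕ.≟ suc a
... | yes refl = trans (cong₂ _+_ (sumTo-δ-out (suc a) Z a (ℕP.<⇒≱ ℕP.≤-refl)) (δ-yes refl)) (ℤP.+-identityˡ _)
... | no ne = trans (cong₂ _+_ (sumTo-δ-in x Z a (ℕP.m<1+n⇒m≤n (ℕP.≤∧≢⇒< le ne))) (δ-no ne)) (ℤP.+-identityʳ _)

δ-shift-in : ∀ x u a z → x ≤ a → δ (x ℕ.+ u) a z ≡ δ u (a ℕ.∸ x) z
δ-shift-in x u a z le with u ℕ.≟ a ℕ.∸ x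
... | yes e = trans (δ-yes (trans (cong (x ℕ.+_) e) (ℕP.m+[n∸m]≡n le))) (sym (δ-yes e))
... | no ne = trans (δ-no (λ e → ne (trans (sym (ℕP.m+n∸m≡n x u)) (cong (ℕ._∸ x) e)))) (sym (δ-no ne))

δ-shift-out : ∀ x u a z → ¬ x ≤ a → δ (x ℕ.+ u) a z ≡ + 0
δ-shift-out x u a z n = δ-no (λ e → n (subst (x ≤_) e (ℕP.m≤m+n x u)))

term*-shift : ∀ c x y t a b → x ≤ a → y ≤ b →
  termCoeff a b (term* (c , x , y) t) ≡ c * termCoeff (a ℕ.∸ x) (b ℕ.∸ y) t
term*-shift c x y (d , u , v) a b x≤a y≤b =
  trans (δ-shift-in x u a _ x≤a)
        (trans (δ-cong u _ (trans (δ-shift-in y v b _ y≤b) (sym (δ-*l c v _ d)))) (sym (δ-*l c u _ _)))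

conv-term : (s : BiTerm) (q : BiPoly) (a b : ℕ) →
  sumL (λ t → termCoeff a b (term* s t)) q
    ≡ sumBox (λ a' b' → termCoeff a' b' s * coeff₂ q (a ℕ.∸ a') (b ℕ.∸ b')) a b
conv-term (c , x , y) q a b = trans (by-cases (x ℕ.≤? a) (y ℕ.≤? b)) (sym rhs-normal)
  where
  open ≡-Reasoning
  Q : ℕ → ℕ → ℤ
  Q a' b' = coeff₂ q (a ℕ.∸ a') (b ℕ.∸ b')
  R : ℤ
  R = sumTo (λ a' → δ x a' (sumTo (λ b' → δ y b' (c * Q a' b')) b)) a
  rhs-normal : sumBox (λ a' b' → termCoeff a' b' (c , x , y) * Q a' b') a b ≡ R
  rhs-normal = sumTo-cong a λ a' →
    trans (sumTo-cong b (λ b' → trans (δ-*r x a' _ _) (δ-cong x a' (δ-*r y b' c _)))) (sumTo-δin x a' _ b)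
  by-cases : Dec (x ≤ a) → Dec (y ≤ b) → sumL (λ t → termCoeff a b (term* (c , x , y) t)) q ≡ R
  by-cases (yes x≤a) (yes y≤b) = begin
    sumL (λ t → termCoeff a b (term* (c , x , y) t)) q   ≡⟨ sumL-cong q (λ t → term*-shift c x y t a b x≤a y≤b) ⟩
    sumL (λ t → c * termCoeff (a ℕ.∸ x) (b ℕ.∸ y) t) q  ≡⟨ sumL-* c _ q ⟩
    c * Q x y                                            ≡⟨ sym (sumTo-δ-in y (λ b' → c * Q x b') b y≤b) ⟩
    sumTo (λ b' → δ y b' (c * Q x b')) b                 ≡⟨ sym (sumTo-δ-in x (λ a' → sumTo (λ b' → δ y b' (c * Q a' b')) b) a x≤a) ⟩
    R                                                    ∎
  by-cases (no x≰a) _ =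
    trans (trans (sumL-cong q (λ { (d , u , v) → δ-shift-out x u a _ x≰a })) (sumL-0 q))
          (sym (sumTo-δ-out x _ a x≰a))
  by-cases (yes x≤a) (no y≰b) =
    trans (trans (sumL-cong q (λ { (d , u , v) →
                   trans (δ-shift-in x u a _ x≤a) (trans (δ-cong u _ (δ-shift-out y v b _ y≰b)) (δ-0 u _)) }))
                 (sumL-0 q))
          (sym (trans (sumTo-δ-in x _ a x≤a) (sumTo-δ-out y _ b y≰b)))

coeff₂-⊗ : ∀ p q a b →
  coeff₂ (p ⊗ q) a b ≡ sumBox (λ a' b' → coeff₂ p a' b' * coeff₂ q (a ℕ.∸ a') (b ℕ.∸ b')) a b
coeff₂-⊗ p q a b = begin
  sumL (termCoeff a b) (p ⊗ q)                                   ≡⟨ sumL-⊗ (termCoeff a b) p q ⟩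
  sumL (λ s → sumL (λ t → termCoeff a b (term* s t)) q) p        ≡⟨ sumL-cong p (λ s → conv-term s q a b) ⟩
  sumL (λ s → sumBox (λ a' b' → termCoeff a' b' s * Q a' b') a b) p ≡⟨ sym (sumTo-sumL _ p a) ⟩
  sumTo (λ a' → sumL (λ s → sumTo (λ b' → termCoeff a' b' s * Q a' b') b) p) a
    ≡⟨ sumTo-cong a (λ a' → sym (sumTo-sumL _ p b)) ⟩
  sumTo (λ a' → sumTo (λ b' → sumL (λ s → termCoeff a' b' s * Q a' b') p) b) a
    ≡⟨ sumBox-cong a b (λ a' b' → trans (sumL-cong p (λ s → ℤP.*-comm (termCoeff a' b' s) _))
                                        (trans (sumL-* (Q a' b') _ p) (ℤP.*-comm (Q a' b') _))) ⟩
  sumBox (λ a' b' → coeff₂ p a' b' * Q a' b') a b                ∎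
  where open ≡-Reasoning
        Q : ℕ → ℕ → ℤ
        Q a' b' = coeff₂ q (a ℕ.∸ a') (b ℕ.∸ b')

⊗-respˡ : ∀ {p p'} q → p ≈ p' → p ⊗ q ≈ p' ⊗ q
⊗-respˡ {p} {p'} q e = mk≈ λ a b →
  trans (coeff₂-⊗ p q a b)
        (trans (sumBox-cong a b (λ x y → cong (_* coeff₂ q (a ℕ.∸ x) (b ℕ.∸ y)) (at e x y))) (sym (coeff₂-⊗ p' q a b)))

⊗-respʳ : ∀ p {q q'} → q ≈ q' → p ⊗ q ≈ p ⊗ q'
⊗-respʳ p {q} {q'} e = ≈-trans (⊗-comm p q) (≈-trans (⊗-respˡ p e) (⊗-comm q' p))

pow-double : ∀ u k → pow u (k ℕ.+ k) ≈ pow (u ⊗ u) k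
pow-double u zero = ≈-refl
pow-double u (suc k) rewrite ℕP.+-suc k k =
  ≈-trans (≈-sym (⊗-assoc u u (pow u (k ℕ.+ k)))) (⊗-respʳ (u ⊗ u) (pow-double u k))

pow-2^ : ∀ u r → pow u (2 ℕ.^ suc r) ≈ pow (u ⊗ u) (2 ℕ.^ r)
pow-2^ u r rewrite cong (2 ℕ.^ r ℕ.+_) (ℕP.+-identityʳ (2 ℕ.^ r)) = pow-double u (2 ℕ.^ r)

-- Congruence modulo 2 of integers

infix 4 _≡₂_
record _≡₂_ (x y : ℤ) : Set where
  constructor mod2
  field
    half : ℤ
    eqn  : x ≡ y + + 2 * half

≡₂-reflexive : ∀ {x y} → x ≡ y → x ≡₂ y
≡₂-reflexive {y = y} x≡y = mod2 (+ 0) (trans x≡y (sym (ℤP.+-identityʳ y)))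

≡₂-refl : ∀ {x} → x ≡₂ x
≡₂-refl = ≡₂-reflexive refl

≡₂-trans : ∀ {x y z} → x ≡₂ y → y ≡₂ z → x ≡₂ z
≡₂-trans {z = z} (mod2 e refl) (mod2 e' refl) = mod2 (e' + e) (regroup z e' e)
  where regroup : ∀ z e' e → z + + 2 * e' + + 2 * e ≡ z + + 2 * (e' + e)
        regroup = solve-∀

≡₂-+ : ∀ {x x' y y'} → x ≡₂ x' → y ≡₂ y' → x + y ≡₂ x' + y'
≡₂-+ {x' = x'} {y' = y'} (mod2 e refl) (mod2 e' refl) = mod2 (e + e') (regroup x' y' e e')
  where regroup : ∀ x' y' e e' → x' + + 2 * e + (y' + + 2 * e') ≡ x' + y' + + 2 * (e + e')
        regroup = solve-∀

≡₂-* : ∀ {x x' y y'} → x ≡₂ x' → y ≡₂ y' → x * y ≡₂ x' * y'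
≡₂-* {x' = x'} {y' = y'} (mod2 e refl) (mod2 e' refl) = mod2 (e * y' + x' * e' + + 2 * e * e') (expand x' y' e e')
  where expand : ∀ x' y' e e' → (x' + + 2 * e) * (y' + + 2 * e') ≡ x' * y' + + 2 * (e * y' + x' * e' + + 2 * e * e')
        expand = solve-∀

-- c² ≡ c (mod 2): by induction for c ≥ 0, and (-s)² = s² ≡ s ≡ -s.
square≡₂ : ∀ c → c * c ≡₂ c
square≡₂ (+ n) = natural n
  where
  natural : ∀ n → + n * + n ≡₂ + n
  natural zero = ≡₂-refl
  natural (suc n) with natural n
  ... | mod2 e n²≡ = mod2 (e + + n) (begin
    + suc n * + suc n                ≡⟨ cong₂ _*_ one+n one+n ⟩
    (+ 1 + + n) * (+ 1 + + n)        ≡⟨ expand (+ n) ⟩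
    + 1 + + 2 * + n + + n * + n      ≡⟨ cong (_+_ (+ 1 + + 2 * + n)) n²≡ ⟩
    + 1 + + 2 * + n + (+ n + + 2 * e) ≡⟨ regroup (+ n) e ⟩
    + 1 + + n + + 2 * (e + + n)      ≡⟨ cong (_+ + 2 * (e + + n)) (sym one+n) ⟩
    + suc n + + 2 * (e + + n)        ∎)
    where
    open ≡-Reasoning
    one+n : + suc n ≡ + 1 + + n
    one+n = ℤP.pos-+ 1 n
    expand : ∀ n → (+ 1 + n) * (+ 1 + n) ≡ + 1 + + 2 * n + n * n
    expand = solve-∀
    regroup : ∀ n e → + 1 + + 2 * n + (n + + 2 * e) ≡ + 1 + n + + 2 * (e + n)
    regroup = solve-∀
square≡₂ -[1+ n ] =
  ≡₂-trans (≡₂-reflexive (neg-square s)) (≡₂-trans (square≡₂ s) (mod2 s (s≡-s+2s s)))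
  where
  s : ℤ
  s = + suc n
  neg-square : ∀ s → - s * - s ≡ s * s
  neg-square = solve-∀
  s≡-s+2s : ∀ s → s ≡ - s + + 2 * s
  s≡-s+2s = solve-∀

power≡₂ : ∀ c K → c ℤ.^ suc K ≡₂ c
power≡₂ c zero = ≡₂-reflexive (ℤP.*-identityʳ c)
power≡₂ c (suc K) = ≡₂-trans (≡₂-* (≡₂-refl {c}) (power≡₂ c K)) (square≡₂ c)

even≡₂0 : ∀ t → + (t ℕ.+ t) ≡₂ + 0
even≡₂0 t = mod2 (+ t) (trans (ℤP.pos-+ t t) (twice (+ t)))
  where twice : ∀ t → t + t ≡ + 0 + + 2 * t
        twice = solve-∀

≡₂⇒∣ : ∀ {x y} → x ≡₂ y → + 2 ∣ (x - y)
≡₂⇒∣ {y = y} (mod2 e refl) = ℕD.divides ℤ.∣ e ∣ (trans (cong ℤ.∣_∣ (difference y e)) (ℤP.abs-* e (+ 2)))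
  where difference : ∀ y e → y + + 2 * e - y ≡ e * + 2
        difference = solve-∀

-- Congruence of bivariate polynomials modulo an integer d

infix 4 _~[_]_
record _~[_]_ (u : BiPoly) (d : ℤ) (v : BiPoly) : Set where
  constructor _,_
  field wit : BiPoly
        eqn : ∀ a b → coeff₂ u a b ≡ coeff₂ v a b + d * coeff₂ wit a b
open _~[_]_ public

≈⇒~ : ∀ {u v} d → u ≈ v → u ~[ d ] v
≈⇒~ {u} {v} d e = [] , λ a b →
  trans (at e a b) (sym (trans (cong (_+_ (coeff₂ v a b)) (ℤP.*-zeroʳ d)) (ℤP.+-identityʳ (coeff₂ v a b))))

~-trans : ∀ {u v x d} → u ~[ d ] v → v ~[ d ] x → u ~[ d ] x
~-trans {u} {v} {x} {d} (w₁ , e₁) (w₂ , e₂) = (w₂ ++ w₁) , λ a b →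
  trans (e₁ a b) (trans (cong (_+ _) (e₂ a b))
    (trans (regroup (coeff₂ x a b) d (coeff₂ w₂ a b) (coeff₂ w₁ a b))
           (cong (λ z → coeff₂ x a b + d * z) (sym (coeff₂-++ w₂ w₁ a b)))))
  where regroup : ∀ X d A B → X + d * A + d * B ≡ X + d * (A + B)
        regroup = solve-∀

~-⊗ : ∀ {u v u' v' d} → u ~[ d ] v → u' ~[ d ] v' → u ⊗ u' ~[ d ] v ⊗ v'
~-⊗ {u} {v} {u'} {v'} {d} (w , e) (w' , e') = (w ⊗ u' ++ v ⊗ w') , coefficients
  where
  open ≡-Reasoning
  U V W U' V' W' : ℕ → ℕ → ℤ
  U = coeff₂ u ; V = coeff₂ v ; W = coeff₂ w ; U' = coeff₂ u' ; V' = coeff₂ v' ; W' = coeff₂ w'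
  expand : ∀ V W V' W' d → (V + d * W) * (V' + d * W') ≡ V * V' + d * (W * (V' + d * W') + V * W')
  expand = solve-∀
  expand-at : ∀ x y x' y' → U x y * U' x' y' ≡ V x y * V' x' y' + d * (W x y * U' x' y' + V x y * W' x' y')
  expand-at x y x' y' = trans (cong₂ _*_ (e x y) (e' x' y'))
    (trans (expand (V x y) (W x y) (V' x' y') (W' x' y') d)
           (cong (λ z → V x y * V' x' y' + d * (W x y * z + V x y * W' x' y')) (sym (e' x' y'))))
  coefficients : ∀ a b → coeff₂ (u ⊗ u') a b ≡ coeff₂ (v ⊗ v') a b + d * coeff₂ (w ⊗ u' ++ v ⊗ w') a b
  coefficients a b = begin
    coeff₂ (u ⊗ u') a b
      ≡⟨ coeff₂-⊗ u u' a b ⟩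
    sumBox (λ x y → U x y * U' (a ℕ.∸ x) (b ℕ.∸ y)) a b
      ≡⟨ sumBox-cong a b (λ x y → expand-at x y (a ℕ.∸ x) (b ℕ.∸ y)) ⟩
    sumBox (λ x y → V x y * V' (a ℕ.∸ x) (b ℕ.∸ y) + d * (W x y * U' (a ℕ.∸ x) (b ℕ.∸ y) + V x y * W' (a ℕ.∸ x) (b ℕ.∸ y))) a b
      ≡⟨ sumBox-lin _ _ d a b ⟩
    sumBox (λ x y → V x y * V' (a ℕ.∸ x) (b ℕ.∸ y)) a b
      + d * sumBox (λ x y → W x y * U' (a ℕ.∸ x) (b ℕ.∸ y) + V x y * W' (a ℕ.∸ x) (b ℕ.∸ y)) a b
      ≡⟨ cong₂ (λ z z' → z + d * z') (sym (coeff₂-⊗ v v' a b))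
           (trans (sumBox-+ _ _ a b) (cong₂ _+_ (sym (coeff₂-⊗ w u' a b)) (sym (coeff₂-⊗ v w' a b)))) ⟩
    coeff₂ (v ⊗ v') a b + d * (coeff₂ (w ⊗ u') a b + coeff₂ (v ⊗ w') a b)
      ≡⟨ cong (λ z → coeff₂ (v ⊗ v') a b + d * z) (sym (coeff₂-++ (w ⊗ u') (v ⊗ w') a b)) ⟩
    coeff₂ (v ⊗ v') a b + d * coeff₂ (w ⊗ u' ++ v ⊗ w') a b ∎

pow-~ : ∀ {u v d} k → u ~[ d ] v → pow u k ~[ d ] pow v k
pow-~ {d = d} zero e = ≈⇒~ d ≈-refl
pow-~ (suc k) e = ~-⊗ e (pow-~ k e)

-- Squaring doubles the 2-adic precision: u ≡ v (mod 2) ⇒ u² ≡ v² (mod 4),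
-- because the cross term 2·(w v + v w) = 4·w v.
square-~ : ∀ {u v} → u ~[ + 2 ] v → u ⊗ u ~[ + 4 ] v ⊗ v
square-~ {u} {v} (w , e) = (w ⊗ v ++ w ⊗ w) , coefficients
  where
  open ≡-Reasoning
  U V W : ℕ → ℕ → ℤ
  U = coeff₂ u ; V = coeff₂ v ; W = coeff₂ w
  expand : ∀ V W V' W' → (V + + 2 * W) * (V' + + 2 * W') ≡ V * V' + + 2 * ((W * V' + V * W') + + 2 * (W * W'))
  expand = solve-∀
  expand-at : ∀ x y x' y' → U x y * U x' y' ≡ V x y * V x' y' + + 2 * ((W x y * V x' y' + V x y * W x' y') + + 2 * (W x y * W x' y'))
  expand-at x y x' y' = trans (cong₂ _*_ (e x y) (e x' y')) (expand (V x y) (W x y) (V x' y') (W x' y'))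
  regroup : ∀ X A B → X + + 2 * ((A + A) + + 2 * B) ≡ X + + 4 * (A + B)
  regroup = solve-∀
  coefficients : ∀ a b → coeff₂ (u ⊗ u) a b ≡ coeff₂ (v ⊗ v) a b + + 4 * coeff₂ (w ⊗ v ++ w ⊗ w) a b
  coefficients a b = begin
    coeff₂ (u ⊗ u) a b
      ≡⟨ coeff₂-⊗ u u a b ⟩
    sumBox (λ x y → U x y * U (a ℕ.∸ x) (b ℕ.∸ y)) a b
      ≡⟨ sumBox-cong a b (λ x y → expand-at x y (a ℕ.∸ x) (b ℕ.∸ y)) ⟩
    sumBox (λ x y → V x y * V (a ℕ.∸ x) (b ℕ.∸ y) + + 2 * Cross x y) a b
      ≡⟨ sumBox-lin _ _ (+ 2) a b ⟩
    sumBox (λ x y → V x y * V (a ℕ.∸ x) (b ℕ.∸ y)) a b + + 2 * sumBox Cross a b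
      ≡⟨ cong₂ (λ z z' → z + + 2 * z') (sym (coeff₂-⊗ v v a b)) cross-sum ⟩
    coeff₂ (v ⊗ v) a b + + 2 * ((coeff₂ (w ⊗ v) a b + coeff₂ (w ⊗ v) a b) + + 2 * coeff₂ (w ⊗ w) a b)
      ≡⟨ regroup (coeff₂ (v ⊗ v) a b) (coeff₂ (w ⊗ v) a b) (coeff₂ (w ⊗ w) a b) ⟩
    coeff₂ (v ⊗ v) a b + + 4 * (coeff₂ (w ⊗ v) a b + coeff₂ (w ⊗ w) a b)
      ≡⟨ cong (λ z → coeff₂ (v ⊗ v) a b + + 4 * z) (sym (coeff₂-++ (w ⊗ v) (w ⊗ w) a b)) ⟩
    coeff₂ (v ⊗ v) a b + + 4 * coeff₂ (w ⊗ v ++ w ⊗ w) a b ∎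
    where
    Cross : ℕ → ℕ → ℤ
    Cross x y = (W x y * V (a ℕ.∸ x) (b ℕ.∸ y) + V x y * W (a ℕ.∸ x) (b ℕ.∸ y))
                + + 2 * (W x y * W (a ℕ.∸ x) (b ℕ.∸ y))
    cross-sum : sumBox Cross a b ≡ (coeff₂ (w ⊗ v) a b + coeff₂ (w ⊗ v) a b) + + 2 * coeff₂ (w ⊗ w) a b
    cross-sum = trans (sumBox-lin _ _ (+ 2) a b)
      (cong₂ (λ z z' → z + + 2 * z')
        (trans (sumBox-+ _ _ a b) (cong₂ _+_ (sym (coeff₂-⊗ w v a b)) (trans (sym (coeff₂-⊗ v w a b)) (at (⊗-comm v w) a b))))
        (sym (coeff₂-⊗ w w a b)))

pow-2^-~ : ∀ {u v} r → u ~[ + 2 ] v → pow u (2 ℕ.^ suc r) ~[ + 4 ] pow v (2 ℕ.^ suc r)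
pow-2^-~ {u} {v} r e = ~-trans (≈⇒~ (+ 4) (pow-2^ u r))
  (~-trans (pow-~ (2 ℕ.^ r) (square-~ e)) (≈⇒~ (+ 4) (≈-sym (pow-2^ v r))))

-- The term-wise square ("Frobenius") of a bivariate polynomial

frob : BiPoly → BiPoly
frob = map (λ t → term* t t)

crossTerms : BiPoly → BiPoly
crossTerms [] = []
crossTerms (t ∷ l) = map (term* t) l ++ crossTerms l

square-frob : ∀ u a b → coeff₂ (u ⊗ u) a b ≡ coeff₂ (frob u) a b + + 2 * coeff₂ (crossTerms u) a b
square-frob [] a b = refl
square-frob (t ∷ l) a b = begin
  T + sumL (termCoeff a b) (map (term* t) l ++ l ⊗ (t ∷ l))
    ≡⟨ cong (_+_ T) (sumL-++ (termCoeff a b) (map (term* t) l) (l ⊗ (t ∷ l))) ⟩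
  T + (X + coeff₂ (l ⊗ (t ∷ l)) a b)
    ≡⟨ cong (λ z → T + (X + z)) (trans (at (⊗-comm l (t ∷ l)) a b) (sumL-++ (termCoeff a b) (map (term* t) l) (l ⊗ l))) ⟩
  T + (X + (X + coeff₂ (l ⊗ l) a b))
    ≡⟨ cong (λ z → T + (X + (X + z))) (square-frob l a b) ⟩
  T + (X + (X + (coeff₂ (frob l) a b + + 2 * coeff₂ (crossTerms l) a b)))
    ≡⟨ regroup T X (coeff₂ (frob l) a b) (coeff₂ (crossTerms l) a b) ⟩
  (T + coeff₂ (frob l) a b) + + 2 * (X + coeff₂ (crossTerms l) a b)
    ≡⟨ cong (λ z → (T + coeff₂ (frob l) a b) + + 2 * z) (sym (coeff₂-++ (map (term* t) l) (crossTerms l) a b)) ⟩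
  (T + coeff₂ (frob l) a b) + + 2 * coeff₂ (crossTerms (t ∷ l)) a b ∎
  where open ≡-Reasoning
        T X : ℤ
        T = termCoeff a b (term* t t)
        X = coeff₂ (map (term* t) l) a b
        regroup : ∀ T X S Q → T + (X + (X + (S + + 2 * Q))) ≡ (T + S) + + 2 * (X + Q)
        regroup = solve-∀

square~frob : ∀ u → u ⊗ u ~[ + 2 ] frob u
square~frob u = crossTerms u , square-frob u

frob^ : ℕ → BiPoly → BiPoly
frob^ zero g = g
frob^ (suc r) g = frob^ r (frob g)

pow-2^~frob : ∀ r g → pow g (2 ℕ.^ suc r) ~[ + 4 ] frob^ r g ⊗ frob^ r g
pow-2^~frob zero g = ≈⇒~ (+ 4) (⊗-respʳ g (⊗-one g))
pow-2^~frob (suc r) g = ~-trans (≈⇒~ (+ 4) (pow-2^ g (suc r)))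
  (~-trans (pow-2^-~ r (square~frob g)) (pow-2^~frob r (frob g)))

sumL-≡₂ : {A : Set} {F G : A → ℤ} → (∀ t → F t ≡₂ G t) → ∀ l → sumL F l ≡₂ sumL G l
sumL-≡₂ F≡G [] = ≡₂-refl
sumL-≡₂ F≡G (x ∷ l) = ≡₂-+ (F≡G x) (sumL-≡₂ F≡G l)

-- Doubling is injective on ℕ; so (2x = 2a) ⇔ (x = a), which lets δ see through frob.
double-injective : ∀ m n → m ℕ.+ m ≡ n ℕ.+ n → m ≡ n
double-injective zero zero _ = refl
double-injective (suc m) (suc n) e =
  cong suc (double-injective m n (ℕP.suc-injective (trans (sym (ℕP.+-suc m m)) (trans (ℕP.suc-injective e) (ℕP.+-suc n n)))))

δ-double : ∀ x a {z z'} → z ≡₂ z' → δ (x ℕ.+ x) (a ℕ.+ a) z ≡₂ δ x a z'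
δ-double x a z≡z' with x ℕ.≟ a
... | yes refl = ≡₂-trans (≡₂-reflexive (δ-yes refl)) (≡₂-trans z≡z' (≡₂-reflexive (sym (δ-yes refl))))
... | no x≢a = ≡₂-reflexive (trans (δ-no (λ e → x≢a (double-injective x a e))) (sym (δ-no x≢a)))

-- [X^(2a) Y^(2b)] frob p ≡ [X^a Y^b] p (mod 2), since c² ≡ c.
frob-coeff≡₂ : ∀ p a b → coeff₂ (frob p) (a ℕ.+ a) (b ℕ.+ b) ≡₂ coeff₂ p a b
frob-coeff≡₂ p a b = ≡₂-trans (≡₂-reflexive (sumL-map (termCoeff (a ℕ.+ a) (b ℕ.+ b)) _ p)) (sumL-≡₂ per-term p)
  where per-term : ∀ t → termCoeff (a ℕ.+ a) (b ℕ.+ b) (term* t t) ≡₂ termCoeff a b t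
        per-term (c , x , y) = δ-double x a (δ-double y b (square≡₂ c))

twice-scale : ∀ K a → (2 ℕ.* K) ℕ.* a ≡ K ℕ.* (a ℕ.+ a)
twice-scale = ℕSolver.solve-∀

twice-scale* : ∀ K a → (2 ℕ.* K) ℕ.* a ≡ K ℕ.* (2 ℕ.* a)
twice-scale* = ℕSolver.solve-∀

frob^-coeff≡₂ : ∀ r p a b → coeff₂ (frob^ r p) (2 ℕ.^ r ℕ.* a) (2 ℕ.^ r ℕ.* b) ≡₂ coeff₂ p a b
frob^-coeff≡₂ zero p a b rewrite ℕP.*-identityˡ a | ℕP.*-identityˡ b = ≡₂-refl
frob^-coeff≡₂ (suc r) p a b rewrite twice-scale (2 ℕ.^ r) a | twice-scale (2 ℕ.^ r) b =
  ≡₂-trans (frob^-coeff≡₂ r (frob p) (a ℕ.+ a) (b ℕ.+ b)) (frob-coeff≡₂ p a b)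

ExpDivisible : ℕ → BiPoly → Set
ExpDivisible k p = All (λ t → k ℕD.∣ proj₁ (proj₂ t) × k ℕD.∣ proj₂ (proj₂ t)) p

all-expDivisible-1 : ∀ p → ExpDivisible 1 p
all-expDivisible-1 [] = []
all-expDivisible-1 (t ∷ p) = (ℕD.1∣ _ , ℕD.1∣ _) ∷ all-expDivisible-1 p

frob-expDivisible : ∀ {d} p → ExpDivisible d p → ExpDivisible (2 ℕ.* d) (frob p)
frob-expDivisible [] [] = []
frob-expDivisible (t ∷ p) ((d∣x , d∣y) ∷ rest) = (double d∣x , double d∣y) ∷ frob-expDivisible p rest
  where double : ∀ {d x} → d ℕD.∣ x → 2 ℕ.* d ℕD.∣ x ℕ.+ x
        double {d} (ℕD.divides q refl) = ℕD.divides q (twice q d)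
          where twice : ∀ q d → q ℕ.* d ℕ.+ q ℕ.* d ≡ q ℕ.* (2 ℕ.* d)
                twice = ℕSolver.solve-∀

frob^-expDivisible : ∀ r p → ExpDivisible (2 ℕ.^ r) (frob^ r p)
frob^-expDivisible r p =
  subst (λ k → ExpDivisible k (frob^ r p)) (ℕP.*-identityʳ (2 ℕ.^ r)) (general r 1 p (all-expDivisible-1 p))
  where
  general : ∀ r d p → ExpDivisible d p → ExpDivisible (2 ℕ.^ r ℕ.* d) (frob^ r p)
  general zero d p h rewrite ℕP.*-identityˡ d = h
  general (suc r) d p h rewrite twice-scale* (2 ℕ.^ r) d = general r (2 ℕ.* d) (frob p) (frob-expDivisible p h)

coeff₂-vanishˡ : ∀ {k} p a b → ExpDivisible k p → ¬ k ℕD.∣ a → coeff₂ p a b ≡ + 0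
coeff₂-vanishˡ [] a b [] k∤a = refl
coeff₂-vanishˡ ((c , x , y) ∷ p) a b ((k∣x , _) ∷ rest) k∤a =
  cong₂ _+_ (δ-no (λ x≡a → k∤a (subst (_ ℕD.∣_) x≡a k∣x))) (coeff₂-vanishˡ p a b rest k∤a)

coeff₂-vanishʳ : ∀ {k} p a b → ExpDivisible k p → ¬ k ℕD.∣ b → coeff₂ p a b ≡ + 0
coeff₂-vanishʳ [] a b [] k∤b = refl
coeff₂-vanishʳ ((c , x , y) ∷ p) a b ((_ , k∣y) ∷ rest) k∤b =
  cong₂ _+_ (trans (δ-cong x a (δ-no (λ y≡b → k∤b (subst (_ ℕD.∣_) y≡b k∣y)))) (δ-0 x a)) (coeff₂-vanishʳ p a b rest k∤b)

-- If all exponents of h are multiples of k > 0, then X^k Y^k in h² only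
-- arises as 1·X^k Y^k and X^k·Y^k (twice each):
--   [X^k Y^k] h² = 2 (h₀₀ h_kk + h₀ₖ h_k0).
diagonal-square : ∀ {k} h → 0 ℕ.< k → ExpDivisible k h →
  coeff₂ (h ⊗ h) k k ≡ + 2 * (coeff₂ h 0 0 * coeff₂ h k k + coeff₂ h 0 k * coeff₂ h k 0)
diagonal-square {suc k'} h (s≤s z≤n) D = begin
  coeff₂ (h ⊗ h) k k
    ≡⟨ coeff₂-⊗ h h k k ⟩
  sumTo (λ a' → sumTo (λ b' → H a' b' * H (k ℕ.∸ a') (k ℕ.∸ b')) k) k
    ≡⟨ sumTo-ends _ k' (λ a 0<a a<k → trans (sumTo-cong k (λ b' → zero-left (H (k ℕ.∸ a) (k ℕ.∸ b'))
                                                   (coeff₂-vanishˡ h a b' D (strictly-inside a 0<a a<k)))) (sumTo-0 k)) ⟩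
  sumTo (λ b' → H 0 b' * H k (k ℕ.∸ b')) k + sumTo (λ b' → H k b' * H (k ℕ.∸ k) (k ℕ.∸ b')) k
    ≡⟨ cong₂ _+_ (sumTo-ends _ k' (λ b 0<b b<k → zero-left (H k (k ℕ.∸ b)) (coeff₂-vanishʳ h 0 b D (strictly-inside b 0<b b<k))))
                 (sumTo-ends _ k' (λ b 0<b b<k → zero-left (H (k ℕ.∸ k) (k ℕ.∸ b)) (coeff₂-vanishʳ h k b D (strictly-inside b 0<b b<k)))) ⟩
  (H 0 0 * H k k + H 0 k * H k (k ℕ.∸ k)) + (H k 0 * H (k ℕ.∸ k) k + H k k * H (k ℕ.∸ k) (k ℕ.∸ k))
    ≡⟨ cong (λ z → (H 0 0 * H k k + H 0 k * H k z) + (H k 0 * H z k + H k k * H z z)) (ℕP.n∸n≡0 k) ⟩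
  (H 0 0 * H k k + H 0 k * H k 0) + (H k 0 * H 0 k + H k k * H 0 0)
    ≡⟨ symmetric-pair (H 0 0) (H k k) (H 0 k) (H k 0) ⟩
  + 2 * (H 0 0 * H k k + H 0 k * H k 0) ∎
  where
  open ≡-Reasoning
  k : ℕ
  k = suc k'
  H : ℕ → ℕ → ℤ
  H = coeff₂ h
  strictly-inside : ∀ a → 0 ℕ.< a → a ℕ.< k → ¬ k ℕD.∣ a
  strictly-inside (suc a) _ a<k = ℕD.>⇒∤ a<k
  zero-left : ∀ {x} (y : ℤ) → x ≡ + 0 → x * y ≡ + 0
  zero-left y refl = refl
  symmetric-pair : ∀ a b c d → (a * b + c * d) + (d * c + b * a) ≡ + 2 * (a * b + c * d)
  symmetric-pair = solve-∀

-- The coefficient of X Y in g^N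

record LowCoeffs (q : BiPoly) (A B C D : ℤ) : Set where
  constructor low
  field l00 : coeff₂ q 0 0 ≡ A
        l10 : coeff₂ q 1 0 ≡ B
        l01 : coeff₂ q 0 1 ≡ C
        l11 : coeff₂ q 1 1 ≡ D

lowCoeffs-⊗ : ∀ p q {A B C D} → LowCoeffs q A B C D →
  let P = coeff₂ p in
  LowCoeffs (p ⊗ q) (P 0 0 * A) (P 0 0 * B + P 1 0 * A) (P 0 0 * C + P 0 1 * A)
                    ((P 0 0 * D + P 0 1 * B) + (P 1 0 * C + P 1 1 * A))
lowCoeffs-⊗ p q {A} {B} {C} {D} (low e00 e10 e01 e11) = low
  (trans (coeff₂-⊗ p q 0 0) (cong (P 0 0 *_) e00))
  (trans (coeff₂-⊗ p q 1 0) (cong₂ (λ u v → P 0 0 * u + P 1 0 * v) e10 e00))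
  (trans (coeff₂-⊗ p q 0 1) (cong₂ (λ u v → P 0 0 * u + P 0 1 * v) e01 e00))
  (trans (coeff₂-⊗ p q 1 1)
    (trans (cong₂ (λ u v → (P 0 0 * u + P 0 1 * v) + (P 1 0 * coeff₂ q 0 1 + P 1 1 * coeff₂ q 0 0)) e11 e10)
           (cong₂ (λ u v → (P 0 0 * D + P 0 1 * B) + (P 1 0 * u + P 1 1 * v)) e01 e00)))
  where P : ℕ → ℕ → ℤ
        P = coeff₂ p

module _ (g : BiPoly) where
  private
    c x y d : ℤ
    c = coeff₂ g 0 0
    x = coeff₂ g 1 0
    y = coeff₂ g 0 1
    d = coeff₂ g 1 1

  -- a = c^(K+1) d + (K+1) c^K x y is the quotient [XY] g^(K+2) / (K+2).
  xyQuotient : ℕ → ℤ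
  xyQuotient K = (c * c ℤ.^ K) * d + (+ 1 + + K) * c ℤ.^ K * x * y

  lowCoeffs-pow : ∀ K → LowCoeffs (pow g (suc (suc K))) (c * (c * c ℤ.^ K))
    ((+ 2 + + K) * (c * c ℤ.^ K) * x) ((+ 2 + + K) * (c * c ℤ.^ K) * y) ((+ 2 + + K) * xyQuotient K)
  lowCoeffs-pow zero with lowCoeffs-⊗ g (g ⊗ one₂)
                            (low (at (⊗-one g) 0 0) (at (⊗-one g) 1 0) (at (⊗-one g) 0 1) (at (⊗-one g) 1 1))
  ... | low e00 e10 e01 e11 = low (trans e00 (const-term c)) (trans e10 (linear-term c x)) (trans e01 (linear-term c y)) (trans e11 (xy-term c x y d))
    where const-term : ∀ c → c * c ≡ c * (c * + 1)
          const-term = solve-∀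
          linear-term : ∀ c x → c * x + x * c ≡ (+ 2 + + 0) * (c * + 1) * x
          linear-term = solve-∀
          xy-term : ∀ c x y d → (c * d + y * x) + (x * y + d * c) ≡ (+ 2 + + 0) * ((c * + 1) * d + (+ 1 + + 0) * + 1 * x * y)
          xy-term = solve-∀
  lowCoeffs-pow (suc K) with lowCoeffs-⊗ g (pow g (suc (suc K))) (lowCoeffs-pow K)
  ... | low e00 e10 e01 e11 = low e00 (trans e10 (linear-term c (c ℤ.^ K) x (+ K))) (trans e01 (linear-term c (c ℤ.^ K) y (+ K)))
                                  (trans e11 (xy-term c (c ℤ.^ K) x y d (+ K)))
    where linear-term : ∀ c P x k → c * ((+ 2 + k) * (c * P) * x) + x * (c * (c * P)) ≡ (+ 3 + k) * (c * (c * P)) * x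
          linear-term = solve-∀
          xy-term : ∀ c P x y d k → (c * ((+ 2 + k) * ((c * P) * d + (+ 1 + k) * P * x * y)) + y * ((+ 2 + k) * (c * P) * x))
                                 + (x * ((+ 2 + k) * (c * P) * y) + d * (c * (c * P)))
                               ≡ (+ 3 + k) * ((c * (c * P)) * d + (+ 2 + k) * (c * P) * x * y)
          xy-term = solve-∀

  xyQuotient-parity : ∀ w → xyQuotient (suc w ℕ.+ suc w) ≡₂ c * d + c * x * y
  xyQuotient-parity w = ≡₂-trans
    (≡₂-+ (≡₂-* (power≡₂ c K) (≡₂-refl {d}))
          (≡₂-* (≡₂-* (≡₂-* (≡₂-+ (≡₂-refl {+ 1}) (even≡₂0 (suc w))) (power≡₂ c (w ℕ.+ suc w))) (≡₂-refl {x})) (≡₂-refl {y})))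
    (≡₂-reflexive (cong (λ z → c * d + z * x * y) (ℤP.*-identityˡ c)))
    where K : ℕ
          K = suc w ℕ.+ suc w

pow2-shape : ∀ n → Σ ℕ λ w → 2 ℕ.^ suc (suc n) ≡ 2 ℕ.+ (suc w ℕ.+ suc w)
pow2-shape n = shape (2 ℕ.^ n) (ℕP.m^n>0 2 n)
  where shape : ∀ p → 0 ℕ.< p → Σ ℕ λ w → 2 ℕ.* (2 ℕ.* p) ≡ 2 ℕ.+ (suc w ℕ.+ suc w)
        shape (suc t) _ = t ℕ.+ t , identity t
          where identity : ∀ t → 2 ℕ.* (2 ℕ.* suc t) ≡ 2 ℕ.+ (suc (t ℕ.+ t) ℕ.+ suc (t ℕ.+ t))
                identity = ℕSolver.solve-∀

xy-coefficient : ∀ g n → let N = 2 ℕ.^ suc (suc n) in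
  Σ ℤ λ a → coeff₂ (pow g N) 1 1 ≡ + N * a
          × a ≡₂ coeff₂ g 0 0 * coeff₂ g 1 1 + coeff₂ g 0 0 * coeff₂ g 1 0 * coeff₂ g 0 1
xy-coefficient g n with pow2-shape n
... | w , N≡ rewrite N≡ = xyQuotient g K , LowCoeffs.l11 (lowCoeffs-pow g K) , xyQuotient-parity g w
  where K : ℕ
        K = suc w ℕ.+ suc w

-- The coefficient of X^k Y^k in g^(2k), k = 2^r

diagonal-coefficient : ∀ g r → let k = 2 ℕ.^ r in
  Σ ℤ λ b → coeff₂ (pow g (2 ℕ.^ suc r)) k k ≡ + 2 * b
          × b ≡₂ coeff₂ g 0 0 * coeff₂ g 1 1 + coeff₂ g 0 1 * coeff₂ g 1 0
diagonal-coefficient g r = Hsum + + 2 * W , coeff-eq , parity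
  where
  open ≡-Reasoning
  k : ℕ
  k = 2 ℕ.^ r
  h : BiPoly
  h = frob^ r g
  H : ℕ → ℕ → ℤ
  H = coeff₂ h
  g^N~h² : pow g (2 ℕ.^ suc r) ~[ + 4 ] h ⊗ h
  g^N~h² = pow-2^~frob r g
  W Hsum : ℤ
  W = coeff₂ (wit g^N~h²) k k
  Hsum = H 0 0 * H k k + H 0 k * H k 0
  coeff-eq : coeff₂ (pow g (2 ℕ.^ suc r)) k k ≡ + 2 * (Hsum + + 2 * W)
  coeff-eq = begin
    coeff₂ (pow g (2 ℕ.^ suc r)) k k ≡⟨ eqn g^N~h² k k ⟩
    coeff₂ (h ⊗ h) k k + + 4 * W     ≡⟨ cong (_+ + 4 * W) (diagonal-square h (ℕP.m^n>0 2 r) (frob^-expDivisible r g)) ⟩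
    + 2 * Hsum + + 4 * W             ≡⟨ factor Hsum W ⟩
    + 2 * (Hsum + + 2 * W)           ∎
    where factor : ∀ X Y → + 2 * X + + 4 * Y ≡ + 2 * (X + + 2 * Y)
          factor = solve-∀
  scaled : ∀ {u v u' v'} → k ℕ.* u ≡ u' → k ℕ.* v ≡ v' → H u' v' ≡₂ coeff₂ g u v
  scaled {u} {v} refl refl = frob^-coeff≡₂ r g u v
  at0 : k ℕ.* 0 ≡ 0
  at0 = ℕP.*-zeroʳ k
  at1 : k ℕ.* 1 ≡ k
  at1 = ℕP.*-identityʳ k
  parity : Hsum + + 2 * W ≡₂ coeff₂ g 0 0 * coeff₂ g 1 1 + coeff₂ g 0 1 * coeff₂ g 1 0
  parity = ≡₂-trans (mod2 W refl) (≡₂-+ (≡₂-* (scaled at0 at0) (scaled at1 at1)) (≡₂-* (scaled at0 at1) (scaled at1 at0)))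

bivariate-lemma : ∀ g n → let N = 2 ℕ.^ suc (suc n) ; k = 2 ℕ.^ suc n
                              c = coeff₂ g 0 0 ; x = coeff₂ g 1 0 ; y = coeff₂ g 0 1 in
  Σ ℤ λ a → Σ ℤ λ b → coeff₂ (pow g N) 1 1 ≡ + N * a × coeff₂ (pow g N) k k ≡ + 2 * b
                    × a + b ≡₂ (c + + 1) * x * y
bivariate-lemma g n =
  let (a , a-eq , a≡₂) = xy-coefficient g n
      (b , b-eq , b≡₂) = diagonal-coefficient g (suc n)
  in a , b , a-eq , b-eq , ≡₂-trans (≡₂-+ a≡₂ b≡₂) (mod2 (c * d) (collect c d x y))
  where
  c x y d : ℤ
  c = coeff₂ g 0 0 ; x = coeff₂ g 1 0 ; y = coeff₂ g 0 1 ; d = coeff₂ g 1 1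
  collect : ∀ c d x y → c * d + c * x * y + (c * d + y * x) ≡ (c + + 1) * x * y + + 2 * (c * d)
  collect = solve-∀

-- Projection of ℤ[x_1,…,x_m] onto the variables x_i, x_j

module Projection {m : ℕ} (i j : Fin m) (i≢j : ¬ i ≡ j) where

  Supported : Exp m → Set
  Supported α = ∀ l → ¬ l ≡ i → ¬ l ≡ j → lookup α l ≡ 0

  supported? : ∀ α → Dec (Supported α)
  supported? α = FinP.all? (λ l → ¬? (l FinP.≟ i) →-dec (¬? (l FinP.≟ j) →-dec (lookup α l ℕ.≟ 0)))

  -- Keep the coefficient c of x^α iff x^α is supported (i.e. set the other variables to 0).
  opaque
    keep : Exp m → ℤ → ℤ
    keep α c = if does (supported? α) then c else + 0

  opaque
    unfolding keep
    keep-yes : ∀ {α c} → Supported α → keep α c ≡ c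
    keep-yes {α} s = if-yes (supported? α) s

    keep-no : ∀ {α c} → ¬ Supported α → keep α c ≡ + 0
    keep-no {α} ¬s = if-no (supported? α) ¬s

  projTerm : ℤ × Exp m → BiTerm
  projTerm (c , α) = (keep α c , lookup α i , lookup α j)

  proj : Poly m → BiPoly
  proj = map projTerm

  lookup-expPair : ∀ a b l →
    lookup (expPair i a j b) l ≡ (if does (l FinP.≟ i) then a else 0) ℕ.+ (if does (l FinP.≟ j) then b else 0)
  lookup-expPair a b l = lookup∘tabulate _ l

  lookup-expPair-i : ∀ a b → lookup (expPair i a j b) i ≡ a
  lookup-expPair-i a b =
    trans (lookup-expPair a b i) (trans (cong₂ ℕ._+_ (if-yes (i FinP.≟ i) refl) (if-no (i FinP.≟ j) i≢j)) (ℕP.+-identityʳ a))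

  lookup-expPair-j : ∀ a b → lookup (expPair i a j b) j ≡ b
  lookup-expPair-j a b =
    trans (lookup-expPair a b j) (cong₂ ℕ._+_ (if-no (j FinP.≟ i) (λ j≡i → i≢j (sym j≡i))) (if-yes (j FinP.≟ j) refl))

  expPair-supported : ∀ a b → Supported (expPair i a j b)
  expPair-supported a b l l≢i l≢j =
    trans (lookup-expPair a b l) (cong₂ ℕ._+_ (if-no (l FinP.≟ i) l≢i) (if-no (l FinP.≟ j) l≢j))

  supported⇒expPair : ∀ α → Supported α → α ≡ expPair i (lookup α i) j (lookup α j)
  supported⇒expPair α s = trans (sym (tabulate∘lookup α)) (tabulate-cong pointwise)
    where
    pointwise : ∀ l → lookup α l ≡ (if does (l FinP.≟ i) then lookup α i else 0) ℕ.+ (if does (l FinP.≟ j) then lookup α j else 0)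
    pointwise l with l FinP.≟ i | l FinP.≟ j
    ... | yes refl | yes refl = ⊥-elim (i≢j refl)
    ... | yes refl | no _ = sym (ℕP.+-identityʳ _)
    ... | no _ | yes refl = refl
    ... | no l≢i | no l≢j = s l l≢i l≢j

  coeff-proj : ∀ (f : Poly m) a b → coeff f (expPair i a j b) ≡ coeff₂ (proj f) a b
  coeff-proj [] a b = refl
  coeff-proj ((c , α) ∷ f) a b = cong₂ _+_ (term-proj (≡-dec ℕ._≟_ α (expPair i a j b))) (coeff-proj f a b)
    where
    term-proj : (d : Dec (α ≡ expPair i a j b)) → (if does d then c else + 0) ≡ termCoeff a b (projTerm (c , α))
    term-proj (yes refl) =
      sym (trans (δ-yes (lookup-expPair-i a b)) (trans (δ-yes (lookup-expPair-j a b)) (keep-yes (expPair-supported a b))))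
    term-proj (no α≢) with supported? α
    ... | no ¬s = sym (trans (δ-cong _ a (trans (δ-cong _ b (keep-no ¬s)) (δ-0 _ b))) (δ-0 _ a))
    ... | yes s with lookup α i ℕ.≟ a | lookup α j ℕ.≟ b
    ...   | yes refl | yes refl = ⊥-elim (α≢ (supported⇒expPair α s))
    ...   | no αᵢ≢a | _ = sym (δ-no αᵢ≢a)
    ...   | yes _ | no αⱼ≢b = sym (trans (δ-cong _ a (δ-no αⱼ≢b)) (δ-0 _ a))

  supported-+ : ∀ α β → Supported (zipWith ℕ._+_ α β) → Supported α × Supported β
  supported-+ α β s = (λ l l≢i l≢j → ℕP.m+n≡0⇒m≡0 _ (sum≡0 l l≢i l≢j))
                    , (λ l l≢i l≢j → ℕP.m+n≡0⇒n≡0 (lookup α l) (sum≡0 l l≢i l≢j))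
    where sum≡0 : ∀ l → ¬ l ≡ i → ¬ l ≡ j → lookup α l ℕ.+ lookup β l ≡ 0
          sum≡0 l l≢i l≢j = trans (sym (lookup-zipWith ℕ._+_ l α β)) (s l l≢i l≢j)

  +-supported : ∀ α β → Supported α → Supported β → Supported (zipWith ℕ._+_ α β)
  +-supported α β sα sβ l l≢i l≢j = trans (lookup-zipWith ℕ._+_ l α β) (cong₂ ℕ._+_ (sα l l≢i l≢j) (sβ l l≢i l≢j))

  keep-* : ∀ α β c d → keep (zipWith ℕ._+_ α β) (c * d) ≡ keep α c * keep β d
  keep-* α β c d with supported? (zipWith ℕ._+_ α β) | supported? α | supported? β
  ... | yes s | yes sα | yes sβ = trans (keep-yes s) (cong₂ _*_ (sym (keep-yes sα)) (sym (keep-yes sβ)))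
  ... | yes s | no ¬sα | _ = ⊥-elim (¬sα (proj₁ (supported-+ α β s)))
  ... | yes s | yes _ | no ¬sβ = ⊥-elim (¬sβ (proj₂ (supported-+ α β s)))
  ... | no ¬s | yes sα | yes sβ = ⊥-elim (¬s (+-supported α β sα sβ))
  ... | no ¬s | no ¬sα | _ = trans (keep-no ¬s) (sym (cong (_* keep β d) (keep-no ¬sα)))
  ... | no ¬s | yes _ | no ¬sβ = trans (keep-no ¬s) (sym (trans (cong (keep α c *_) (keep-no ¬sβ)) (ℤP.*-zeroʳ (keep α c))))

  proj-* : ∀ (f g : Poly m) → proj (f *P g) ≈ proj f ⊗ proj g
  proj-* f g = mk≈ λ a b → begin
    sumL (termCoeff a b) (map projTerm (f *P g))
      ≡⟨ sumL-map (termCoeff a b) projTerm (f *P g) ⟩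
    sumL (λ u → termCoeff a b (projTerm u)) (f *P g)
      ≡⟨ sumL-concatMap _ _ f ⟩
    sumL (λ s → sumL (λ u → termCoeff a b (projTerm u)) (map (λ t → (proj₁ s * proj₁ t , zipWith ℕ._+_ (proj₂ s) (proj₂ t))) g)) f
      ≡⟨ sumL-cong f (λ s → trans (sumL-map _ _ g) (sumL-cong g (λ t → cong (termCoeff a b) (projTerm-* s t)))) ⟩
    sumL (λ s → sumL (λ t → termCoeff a b (term* (projTerm s) (projTerm t))) g) f
      ≡⟨ sym (trans (sumL-map _ projTerm f) (sumL-cong f (λ s → sumL-map _ projTerm g))) ⟩
    sumL (λ s' → sumL (λ t' → termCoeff a b (term* s' t')) (proj g)) (proj f)
      ≡⟨ sym (sumL-⊗ (termCoeff a b) (proj f) (proj g)) ⟩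
    sumL (termCoeff a b) (proj f ⊗ proj g) ∎
    where
    open ≡-Reasoning
    projTerm-* : ∀ (s t : ℤ × Exp m) →
      projTerm (proj₁ s * proj₁ t , zipWith ℕ._+_ (proj₂ s) (proj₂ t)) ≡ term* (projTerm s) (projTerm t)
    projTerm-* (c , α) (d , β) rewrite lookup-zipWith ℕ._+_ i α β | lookup-zipWith ℕ._+_ j α β | keep-* α β c d = refl

  proj-pow : ∀ (f : Poly m) N → proj (f ^P N) ≈ pow (proj f) N
  proj-pow f zero rewrite lookup-replicate i 0 | lookup-replicate j 0
                        | keep-yes {replicate m 0} {+ 1} (λ l _ _ → lookup-replicate l 0) = ≈-refl
  proj-pow f (suc N) = ≈-trans (proj-* f (f ^P N)) (⊗-respʳ (proj f) (proj-pow f N))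

  expOne≡ : expOne ≡ expPair i 0 j 0
  expOne≡ = trans (sym (tabulate∘lookup (replicate m 0)))
    (tabulate-cong λ l → trans (lookup-replicate l 0) (sym (cong₂ ℕ._+_ (if-eta (does (l FinP.≟ i))) (if-eta (does (l FinP.≟ j))))))

  expVar-i≡ : expVar i ≡ expPair i 1 j 0
  expVar-i≡ = tabulate-cong λ l → sym (trans (cong (_ ℕ.+_) (if-eta (does (l FinP.≟ j)))) (ℕP.+-identityʳ _))

  expVar-j≡ : expVar j ≡ expPair i 0 j 1
  expVar-j≡ = tabulate-cong λ l → sym (cong (ℕ._+ _) (if-eta (does (l FinP.≟ i))))

lemma2p1 : (m : ℕ) → 1 ≤ m → (n : ℕ) → 2 ≤ n → (f : Poly m) →
    (i j : Fin m) → i < j →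
    Σ ℤ (λ a → Σ ℤ (λ b →
    (coeff (f ^P (2 ℕ.^ n)) (expPair i 1 j 1) ≡ + (2 ℕ.^ n) ℤ.* a)
    × (coeff (f ^P (2 ℕ.^ n)) (expPair i (2 ℕ.^ (n ℕ.∸ 1)) j (2 ℕ.^ (n ℕ.∸ 1))) ≡ + 2 ℤ.* b)
    × (+ 2 ∣ ((a ℤ.+ b) ℤ.- ((coeff f expOne ℤ.+ + 1) ℤ.* coeff f (expVar i) ℤ.* coeff f (expVar j))))))
lemma2p1 m _ (suc (suc n)) (s≤s (s≤s _)) f i j i<j =
  let (a , b , a-eq , b-eq , a+b≡₂) = bivariate-lemma (proj f) n
  in a , b , coeff-pow N 1 1 a-eq , coeff-pow N k k b-eq ,
     subst (λ z → + 2 ∣ (a + b) - z) low-coeffs (≡₂⇒∣ a+b≡₂)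
  where
  open Projection i j (FinP.<⇒≢ i<j)
  N k : ℕ
  N = 2 ℕ.^ suc (suc n)
  k = 2 ℕ.^ suc n
  coeff-pow : ∀ M u v {z} → coeff₂ (pow (proj f) M) u v ≡ z → coeff (f ^P M) (expPair i u j v) ≡ z
  coeff-pow M u v eq = trans (coeff-proj (f ^P M) u v) (trans (at (proj-pow f M) u v) eq)
  low-coeffs : (coeff₂ (proj f) 0 0 + + 1) * coeff₂ (proj f) 1 0 * coeff₂ (proj f) 0 1
             ≡ (coeff f expOne + + 1) * coeff f (expVar i) * coeff f (expVar j)
  low-coeffs = sym (cong₂ _*_ (cong₂ (λ c x → (c + + 1) * x) const≡ xᵢ≡) xⱼ≡)
    where
    const≡ : coeff f expOne ≡ coeff₂ (proj f) 0 0
    const≡ = trans (cong (coeff f) expOne≡) (coeff-proj f 0 0)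
    xᵢ≡ : coeff f (expVar i) ≡ coeff₂ (proj f) 1 0
    xᵢ≡ = trans (cong (coeff f) expVar-i≡) (coeff-proj f 1 0)
    xⱼ≡ : coeff f (expVar j) ≡ coeff₂ (proj f) 0 1
    xⱼ≡ = trans (cong (coeff f) expVar-j≡) (coeff-proj f 0 1)
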